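{- Let $k$ and $n_0$ be positive integers. If there exists a finite, simple, connected graph of order $n_0$ with metric dimension $k$ and exactly one metric basis, then for every integer $n\geq n_0$ there exists a finite, simple, connected graph of order $n$ with metric dimension $k$ and exactly one metric basis.
   Context: For vertices $u,v$ of a connected graph $G$, $d(u,v)$ is the distance between them. For an ordered set $W=\{w_1,\dots,w_k\}\subseteq V(G)$ and $v\in V(G)$, $r(v|W)=(d(v,w_1),\dots,d(v,w_k))$. $W$ is a resolving set if distinct vertices have distinct representations $r(\cdot|W)$. A resolving set of minimum cardinality is a metric basis; its cardinality is the metric dimension $\beta(G)$. -}

module Defs where

open import Data.Nat using (ℕ; zero; suc; _≤_)
open import Data.Fin using (Fin)
open import Data.Fin.Subset using (Subset; _∈_; ∣_∣)
open import Data.Bool using (Bool; true; false)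
open import Data.Product using (Σ; _×_; ∃)
open import Relation.Binary.PropositionalEquality using (_≡_)
open import Relation.Nullary using (¬_)

record Graph (n : ℕ) : Set where
  field
    adj    : Fin n → Fin n → Bool
    sym    : ∀ u v → adj u v ≡ adj v u
    irrefl : ∀ u → adj u u ≡ false
open Graph public

data Walk {n : ℕ} (G : Graph n) : Fin n → Fin n → ℕ → Set where
  here : ∀ {u} → Walk G u u zero
  step : ∀ {u v w ℓ} → adj G u v ≡ true → Walk G v w ℓ → Walk G u w (suc ℓ)

Connected : ∀ {n} → Graph n → Set
Connected G = ∀ u v → ∃ λ ℓ → Walk G u v ℓ

Dist : ∀ {n} → Graph n → Fin n → Fin n → ℕ → Set
Dist G u v m = Walk G u v m × (∀ ℓ → Walk G u v ℓ → m ≤ ℓ)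

Resolving : ∀ {n} → Graph n → Subset n → Set
Resolving G W =
  ∀ u v → (∀ w → w ∈ W → ∀ a b → Dist G u w a → Dist G v w b → a ≡ b) → u ≡ v

MetricBasis : ∀ {n} → Graph n → Subset n → Set
MetricBasis G W = Resolving G W × (∀ W′ → Resolving G W′ → ∣ W ∣ ≤ ∣ W′ ∣)

MetricDim : ∀ {n} → Graph n → ℕ → Set
MetricDim G k = Σ _ λ W → MetricBasis G W × ∣ W ∣ ≡ k

UniqueBasis : ∀ {n} → Graph n → Set
UniqueBasis G = Σ _ λ W → MetricBasis G W × (∀ W′ → MetricBasis G W′ → W′ ≡ W)

-- Attach a leaf to a vertex v outside the unique basis W that is farthest, among the vertices
-- outside W, from a fixed w ∈ W. Distances between old vertices are unchanged, so W still
-- resolves them; and an old vertex u with the leaf's distances would be one step farther from w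
-- than v, hence u ∈ W, but then W sees u at distance 0 and the leaf at positive distance.
-- Conversely a resolving set of the new graph, with the leaf traded for v, resolves G; so the
-- metric dimension is unchanged and any basis of the new graph omits the leaf and restricts to W.
module Submission where

open import Defs hiding (sym)
open import Data.Bool using (Bool; true; false) renaming (_≟_ to _≟ᵇ_)
open import Data.Fin using (Fin; zero; suc)
open import Data.Fin.Properties using (_≟_; any?; ¬∀⟶∃¬; suc-injective)
open import Data.Fin.Subset
  using (Subset; inside; outside; _∈_; _∉_; ∣_∣; ⊤; _-_; ⁅_⁆; _∪_; Nonempty)
open import Data.Fin.Subset.Properties
  using (_∈?_; nonempty?; Empty-unique; ∣⊥∣≡0; ∈⊤; x∈⁅x⁆; x∈p∪q⁺; ∪-identityˡ;
         x∈p∧x≢y⇒x∈p-y; x∈p⇒∣p-x∣<∣p∣; p⊆q⇒∣p∣≤∣q∣; ∣p∣≤∣x∷p∣)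
open import Data.List using (upTo; allFin; filter)
open import Data.List.Extrema.Nat
  using (min; argmin-all; min≤⊤; min≤xs; argmax; argmax-all; f[xs]≤f[argmax])
open import Data.List.Membership.Propositional.Properties
  using (∈-filter⁺; ∈-upTo⁺; ∈-allFin)
open import Data.List.Relation.Unary.All using (lookup)
open import Data.List.Relation.Unary.All.Properties using (all-filter)
open import Data.Nat using (ℕ; zero; suc; _≤_; _<_; _≤′_; z≤n; s≤s; ≤′-refl; ≤′-step)
open import Data.Nat.Properties
  using (≤-refl; ≤-trans; ≤-antisym; n≤1+n; m≤n⇒m≤1+n; ≮⇒≥; _<?_; >⇒≢; <-irrefl; ≤⇒≤′;
         module ≤-Reasoning)
open import Data.Sum using (inj₁; inj₂)
open import Data.Product using (Σ; _×_; _,_; proj₁; proj₂; ∃)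
open import Function using (id)
open import Data.Vec using (_∷_; here; there)
open import Relation.Binary.PropositionalEquality
  using (_≡_; refl; sym; trans; cong; subst; subst₂)
open import Relation.Nullary using (¬_; Dec; yes; no; does; contradiction; ¬?)
open import Relation.Nullary.Decidable using (map′; _×-dec_; dec-true)
open import Relation.Unary using (Decidable)

private
  variable
    n : ℕ

least-witness : {P : ℕ → Set} → Decidable P → ∀ {n} → P n →
  ∃ λ m → P m × (∀ k → P k → m ≤ k)
least-witness {P} P? {n} Pn = m , argmin-all id Pn (all-filter P? (upTo n)) , minimal
  where
  m : ℕ
  m = min n (filter P? (upTo n))
  minimal : ∀ k → P k → m ≤ k
  minimal k Pk with k <? n
  ... | yes k<n = lookup (min≤xs n (filter P? (upTo n))) (∈-filter⁺ P? (∈-upTo⁺ k<n) Pk)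
  ... | no k≮n = ≤-trans (min≤⊤ n (filter P? (upTo n))) (≮⇒≥ k≮n)

maximiser : {P : Fin n → Set} → Decidable P → (f : Fin n → ℕ) → ∀ {x} → P x →
  ∃ λ v → P v × (∀ u → P u → f u ≤ f v)
maximiser {n} P? f Px =
  v , argmax-all f Px (all-filter P? (allFin n)) ,
  λ u Pu → lookup (f[xs]≤f[argmax] _ (filter P? (allFin n))) (∈-filter⁺ P? (∈-allFin u) Pu)
  where
  v : Fin n
  v = argmax f _ (filter P? (allFin n))

0<∣p∣⇒Nonempty : (p : Subset n) → 0 < ∣ p ∣ → Nonempty p
0<∣p∣⇒Nonempty {n} p ∣p∣>0 with nonempty? p
... | yes p≢∅ = p≢∅
... | no p≡∅ = contradiction (trans (cong ∣_∣ (Empty-unique p≡∅)) (∣⊥∣≡0 n)) (>⇒≢ ∣p∣>0)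

≤′-propagate : {P : ℕ → Set} → (∀ {k} → P k → P (suc k)) → ∀ {m n} → m ≤′ n → P m → P n
≤′-propagate grow ≤′-refl Pm = Pm
≤′-propagate grow (≤′-step m≤′n) Pm = grow (≤′-propagate grow m≤′n Pm)

∣⁅x⁆∪p∣≤1+∣p∣ : (x : Fin n) (p : Subset n) → ∣ ⁅ x ⁆ ∪ p ∣ ≤ suc ∣ p ∣
∣⁅x⁆∪p∣≤1+∣p∣ {suc n} zero    (s ∷ p) rewrite ∪-identityˡ p = s≤s (∣p∣≤∣x∷p∣ s p)
∣⁅x⁆∪p∣≤1+∣p∣         (suc x) (inside ∷ p)  = s≤s (∣⁅x⁆∪p∣≤1+∣p∣ x p)
∣⁅x⁆∪p∣≤1+∣p∣         (suc x) (outside ∷ p) = ∣⁅x⁆∪p∣≤1+∣p∣ x p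

≟-true⇒≡ : {x y : Fin n} → does (x ≟ y) ≡ true → x ≡ y
≟-true⇒≡ {x = x} {y} e with x ≟ y
≟-true⇒≡ e | yes x≡y = x≡y
≟-true⇒≡ () | no _

module _ (G : Graph n) where

  Dist-unique : ∀ {u w a b} → Dist G u w a → Dist G u w b → a ≡ b
  Dist-unique (walk-a , min-a) (walk-b , min-b) = ≤-antisym (min-a _ walk-b) (min-b _ walk-a)

  Dist-refl : ∀ u → Dist G u u 0
  Dist-refl u = here , λ _ _ → z≤n

  Dist-zero⇒≡ : ∀ {u w} → Dist G u w 0 → u ≡ w
  Dist-zero⇒≡ (here , _) = refl

  walk? : ∀ u w ℓ → Dec (Walk G u w ℓ)
  walk? u w zero = map′ (λ { refl → here }) (λ { here → refl }) (u ≟ w)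
  walk? u w (suc ℓ) =
    map′ (λ (x , ux , xw) → step ux xw) (λ { (step ux xw) → _ , ux , xw })
         (any? λ x → (adj G u x ≟ᵇ true) ×-dec walk? x w ℓ)

  dist : Connected G → ∀ u w → ∃ (Dist G u w)
  dist conn u w = least-witness (walk? u w) (proj₂ (conn u w))

  SameDistances : Subset n → Fin n → Fin n → Set
  SameDistances W u u′ = ∀ w → w ∈ W → ∀ a b → Dist G u w a → Dist G u′ w b → a ≡ b

  SameDistances-sym : ∀ {W u u′} → SameDistances W u u′ → SameDistances W u′ u
  SameDistances-sym same w w∈W a b da db = sym (same w w∈W b a db da)

  SameDistances-to-member : Connected G → ∀ {W u u′} → u′ ∈ W → SameDistances W u u′ → u ≡ u′
  SameDistances-to-member conn {u = u} {u′} u′∈W same =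
    Dist-zero⇒≡ (subst (Dist G u u′) (same u′ u′∈W _ 0 du (Dist-refl u′)) du)
    where
    du : Dist G u u′ _
    du = proj₂ (dist conn u u′)

  all-but-one-resolving : Connected G → ∀ x → Resolving G (⊤ - x)
  all-but-one-resolving conn x u u′ same with u′ ≟ x | u ≟ x
  ... | no u′≢x | _ = SameDistances-to-member conn (x∈p∧x≢y⇒x∈p-y ∈⊤ u′≢x) same
  ... | yes u′≡x | yes u≡x = trans u≡x (sym u′≡x)
  ... | yes _ | no u≢x =
    sym (SameDistances-to-member conn (x∈p∧x≢y⇒x∈p-y ∈⊤ u≢x) (SameDistances-sym same))

  MetricBasis-misses-vertex : Connected G → ∀ {W} → MetricBasis G W → Fin n → ∃ λ v → v ∉ W
  MetricBasis-misses-vertex conn {W} (_ , minimal) x = ¬∀⟶∃¬ n (_∈ W) (_∈? W) λ all∈W →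
    <-irrefl refl (begin-strict
      ∣ ⊤ - x ∣  <⟨ x∈p⇒∣p-x∣<∣p∣ {p = ⊤ {n}} ∈⊤ ⟩
      ∣ ⊤ {n} ∣  ≤⟨ p⊆q⇒∣p∣≤∣q∣ {p = ⊤ {n}} (λ {y} _ → all∈W y) ⟩
      ∣ W ∣      ≤⟨ minimal (⊤ - x) (all-but-one-resolving conn x) ⟩
      ∣ ⊤ - x ∣  ∎)
    where open ≤-Reasoning

  FarthestOutside : Subset n → Fin n → Fin n → Set
  FarthestOutside W w v = v ∉ W × (∀ {u a b} → u ∉ W → Dist G u w a → Dist G v w b → a ≤ b)

  farthest-outside : Connected G → ∀ {W} → MetricBasis G W → ∀ w → ∃ (FarthestOutside W w)
  farthest-outside conn {W} basis w =
    let o , o∉W = MetricBasis-misses-vertex conn basis w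
        v , v∉W , maximal = maximiser (λ u → ¬? (u ∈? W)) (λ u → proj₁ (dist conn u w)) o∉W
    in v , v∉W , λ {u} u∉W du dv →
         subst₂ _≤_ (Dist-unique (proj₂ (dist conn u w)) du) (Dist-unique (proj₂ (dist conn v w)) dv)
                (maximal u u∉W)

-- G with a new leaf 0 attached to v; vertex i of G becomes suc i.
module Pendant (G : Graph n) (v : Fin n) where

  pendant-adj : Fin (suc n) → Fin (suc n) → Bool
  pendant-adj zero    zero    = false
  pendant-adj zero    (suc j) = does (j ≟ v)
  pendant-adj (suc i) zero    = does (i ≟ v)
  pendant-adj (suc i) (suc j) = adj G i j

  pendant : Graph (suc n)
  pendant = record { adj = pendant-adj ; sym = adj-sym ; irrefl = adj-irrefl }
    where
    adj-sym : ∀ x y → pendant-adj x y ≡ pendant-adj y x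
    adj-sym zero    zero    = refl
    adj-sym zero    (suc j) = refl
    adj-sym (suc i) zero    = refl
    adj-sym (suc i) (suc j) = Graph.sym G i j
    adj-irrefl : ∀ x → pendant-adj x x ≡ false
    adj-irrefl zero    = refl
    adj-irrefl (suc i) = irrefl G i

  leaf : Fin (suc n)
  leaf = zero

  lift-walk : ∀ {u w m} → Walk G u w m → Walk pendant (suc u) (suc w) m
  lift-walk here           = here
  lift-walk (step uv walk) = step uv (lift-walk walk)

  walk-to-leaf : ∀ {u m} → Walk G u v m → Walk pendant (suc u) leaf (suc m)
  walk-to-leaf here           = step (dec-true (v ≟ v) refl) here
  walk-to-leaf (step uv walk) = step uv (walk-to-leaf walk)

  walk-from-leaf : ∀ {w m} → Walk G v w m → Walk pendant leaf (suc w) (suc m)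
  walk-from-leaf walk = step (dec-true (v ≟ v) refl) (lift-walk walk)

  -- Erasing the detours through the leaf shortens a walk of the pendant graph to a walk of G.
  mutual
    unlift-walk : ∀ {u w ℓ} → Walk pendant (suc u) (suc w) ℓ → Σ ℕ λ m → m ≤ ℓ × Walk G u w m
    unlift-walk here = 0 , z≤n , here
    unlift-walk (step {v = suc x} ux walk) with m , m≤ℓ , walk′ ← unlift-walk walk =
      suc m , s≤s m≤ℓ , step ux walk′
    unlift-walk {u} (step {v = zero} u~leaf walk) with refl ← ≟-true⇒≡ {x = u} u~leaf
                                             | m , m<ℓ , walk′ ← unlift-walk-from-leaf walk =
      m , m≤n⇒m≤1+n (≤-trans (n≤1+n m) m<ℓ) , walk′

    unlift-walk-from-leaf : ∀ {w ℓ} → Walk pendant leaf (suc w) ℓ → Σ ℕ λ m → suc m ≤ ℓ × Walk G v w m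
    unlift-walk-from-leaf (step {v = suc x} leaf~x walk) with refl ← ≟-true⇒≡ {x = x} leaf~x
                                                       | m , m≤ℓ , walk′ ← unlift-walk walk =
      m , s≤s m≤ℓ , walk′

  unlift-walk-to-leaf : ∀ {u ℓ} → Walk pendant (suc u) leaf ℓ → Σ ℕ λ m → suc m ≤ ℓ × Walk G u v m
  unlift-walk-to-leaf (step {v = suc x} ux walk) with m , m<ℓ , walk′ ← unlift-walk-to-leaf walk =
    suc m , s≤s m<ℓ , step ux walk′
  unlift-walk-to-leaf {u} (step {v = zero} u~leaf _) with refl ← ≟-true⇒≡ {x = u} u~leaf =
    0 , s≤s z≤n , here

  lift-Dist : ∀ {u w m} → Dist G u w m → Dist pendant (suc u) (suc w) m
  lift-Dist (walk , shortest) = lift-walk walk , λ ℓ walk⁺ →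
    let m , m≤ℓ , walk′ = unlift-walk walk⁺ in ≤-trans (shortest m walk′) m≤ℓ

  Dist-to-leaf : ∀ {u m} → Dist G u v m → Dist pendant (suc u) leaf (suc m)
  Dist-to-leaf (walk , shortest) = walk-to-leaf walk , λ ℓ walk⁺ →
    let m , m<ℓ , walk′ = unlift-walk-to-leaf walk⁺ in ≤-trans (s≤s (shortest m walk′)) m<ℓ

  Dist-from-leaf : ∀ {w m} → Dist G v w m → Dist pendant leaf (suc w) (suc m)
  Dist-from-leaf (walk , shortest) = walk-from-leaf walk , λ ℓ walk⁺ →
    let m , m<ℓ , walk′ = unlift-walk-from-leaf walk⁺ in ≤-trans (s≤s (shortest m walk′)) m<ℓ

  pendant-connected : Connected G → Connected pendant
  pendant-connected conn zero    zero    = 0 , here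
  pendant-connected conn zero    (suc w) = let m , walk = conn v w in suc m , walk-from-leaf walk
  pendant-connected conn (suc u) zero    = let m , walk = conn u v in suc m , walk-to-leaf walk
  pendant-connected conn (suc u) (suc w) = let m , walk = conn u w in m , lift-walk walk

  unlift-Dist : Connected G → ∀ {u w a} → Dist pendant (suc u) (suc w) a → Dist G u w a
  unlift-Dist conn {u} {w} da =
    let m , dm = dist G conn u w in subst (Dist G u w) (Dist-unique pendant (lift-Dist dm) da) dm

  unlift-Dist-to-leaf : Connected G → ∀ {u a} → Dist pendant (suc u) leaf a →
    Σ ℕ λ m → a ≡ suc m × Dist G u v m
  unlift-Dist-to-leaf conn {u} da =
    let m , dm = dist G conn u v in m , Dist-unique pendant da (Dist-to-leaf dm) , dm

  restrict : Subset (suc n) → Subset n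
  restrict (inside  ∷ S) = ⁅ v ⁆ ∪ S
  restrict (outside ∷ S) = S

  ∣restrict∣≤∣∣ : ∀ S → ∣ restrict S ∣ ≤ ∣ S ∣
  ∣restrict∣≤∣∣ (inside  ∷ S) = ∣⁅x⁆∪p∣≤1+∣p∣ v S
  ∣restrict∣≤∣∣ (outside ∷ S) = ≤-refl

  leaf∈⇒v∈restrict : ∀ S → leaf ∈ S → v ∈ restrict S
  leaf∈⇒v∈restrict (inside ∷ S) here = x∈p∪q⁺ (inj₁ (x∈⁅x⁆ v))

  suc∈⇒∈restrict : ∀ S {w} → suc w ∈ S → w ∈ restrict S
  suc∈⇒∈restrict (inside  ∷ S) (there w∈S) = x∈p∪q⁺ (inj₂ w∈S)
  suc∈⇒∈restrict (outside ∷ S) (there w∈S) = w∈S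

  restrict-resolving : Connected G → ∀ S → Resolving pendant S → Resolving G (restrict S)
  restrict-resolving conn S resolving u u′ same = suc-injective (resolving (suc u) (suc u′) same⁺)
    where
    same⁺ : SameDistances pendant S (suc u) (suc u′)
    same⁺ zero leaf∈S a b da db =
      let m  , a≡ , dm  = unlift-Dist-to-leaf conn da
          m′ , b≡ , dm′ = unlift-Dist-to-leaf conn db
      in trans a≡ (trans (cong suc (same v (leaf∈⇒v∈restrict S leaf∈S) m m′ dm dm′)) (sym b≡))
    same⁺ (suc w) w∈S a b da db =
      same w (suc∈⇒∈restrict S w∈S) a b (unlift-Dist conn da) (unlift-Dist conn db)

  pendant-minimal : Connected G → ∀ {W} → MetricBasis G W → ∀ S → Resolving pendant S → ∣ W ∣ ≤ ∣ S ∣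
  pendant-minimal conn (_ , minimal) S resolving =
    ≤-trans (minimal (restrict S) (restrict-resolving conn S resolving)) (∣restrict∣≤∣∣ S)

  module _ (conn : Connected G) {W w} (w∈W : w ∈ W) (far : FarthestOutside G W w v) where

    leaf-separated : ∀ u → ¬ SameDistances pendant (outside ∷ W) leaf (suc u)
    leaf-separated u same with a , du ← dist G conn u w | b , dv ← dist G conn v w =
      <-irrefl refl (subst (_≤ b) (sym leaf-farther) (proj₂ far u∉W du dv))
      where
      leaf-farther : suc b ≡ a
      leaf-farther = same (suc w) (there w∈W) (suc b) a (Dist-from-leaf dv) (lift-Dist du)
      u∉W : u ∉ W
      u∉W u∈W with () ← SameDistances-to-member pendant (pendant-connected conn) (there u∈W) same

    pendant-resolving : Resolving G W → Resolving pendant (outside ∷ W)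
    pendant-resolving resolving zero    zero     same = refl
    pendant-resolving resolving zero    (suc u)  same = contradiction same (leaf-separated u)
    pendant-resolving resolving (suc u) zero     same =
      contradiction (SameDistances-sym pendant same) (leaf-separated u)
    pendant-resolving resolving (suc u) (suc u′) same = cong suc (resolving u u′ λ w w∈W a b da db →
      same (suc w) (there w∈W) a b (lift-Dist da) (lift-Dist db))

  pendant-unique : Connected G → ∀ {W} → MetricBasis G W → (∀ S → MetricBasis G S → S ≡ W) →
    v ∉ W → Resolving pendant (outside ∷ W) → ∀ S → MetricBasis pendant S → S ≡ outside ∷ W
  pendant-unique conn {W} (_ , minimalW) unique v∉W resolving⁺ (s ∷ S) (resolving , minimal) =
    conclude s (unique (restrict (s ∷ S)) (restrict-resolving conn (s ∷ S) resolving , smallest))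
    where
    smallest : ∀ R → Resolving G R → ∣ restrict (s ∷ S) ∣ ≤ ∣ R ∣
    smallest R resolvingR =
      ≤-trans (∣restrict∣≤∣∣ (s ∷ S)) (≤-trans (minimal _ resolving⁺) (minimalW R resolvingR))
    conclude : ∀ s → restrict (s ∷ S) ≡ W → s ∷ S ≡ outside ∷ W
    conclude inside  eq = contradiction (subst (v ∈_) eq (x∈p∪q⁺ (inj₁ (x∈⁅x⁆ v)))) v∉W
    conclude outside eq = cong (outside ∷_) eq

UniqueBasisGraph : ℕ → ℕ → Set
UniqueBasisGraph k n = Σ (Graph n) λ G → Connected G × MetricDim G k × UniqueBasis G

pendant-step : ∀ {k n} → 1 ≤ k → UniqueBasisGraph k n → UniqueBasisGraph k (suc n)
pendant-step k≥1 (G , conn , (W₀ , basis₀ , ∣W₀∣≡k) , (W , basis , unique))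
  with refl ← unique W₀ basis₀
  with w , w∈W ← 0<∣p∣⇒Nonempty W (subst (1 ≤_) (sym ∣W₀∣≡k) k≥1)
  with v , v-farthest ← farthest-outside G conn basis w =
  pendant , pendant-connected conn , (outside ∷ W , basis⁺ , ∣W₀∣≡k) , (outside ∷ W , basis⁺ , unique⁺)
  where
  open Pendant G v
  resolving⁺ : Resolving pendant (outside ∷ W)
  resolving⁺ = pendant-resolving conn w∈W v-farthest (proj₁ basis)
  basis⁺ : MetricBasis pendant (outside ∷ W)
  basis⁺ = resolving⁺ , pendant-minimal conn basis
  unique⁺ : ∀ S → MetricBasis pendant S → S ≡ outside ∷ W
  unique⁺ = pendant-unique conn basis unique (proj₁ v-farthest) resolving⁺

theorem6 : (k n₀ : ℕ) → 1 ≤ k → 1 ≤ n₀ →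
    Σ (Graph n₀) (λ G → Connected G × MetricDim G k × UniqueBasis G) →
    (n : ℕ) → n₀ ≤ n →
    Σ (Graph n) (λ G → Connected G × MetricDim G k × UniqueBasis G)
theorem6 k n₀ k≥1 _ realised n n₀≤n = ≤′-propagate (pendant-step k≥1) (≤⇒≤′ n₀≤n) realised
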